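{- Let $G=(V,E)$ be an undirected graph with $V=\{0,1,\dots,n-1\}$ (ordered as integers), where $E$ is viewed as a symmetric set of ordered pairs (so $(u,v)\in E$ iff $(v,u)\in E$). Run the iterative algorithm described in the context starting from $f=\mathrm{id}$. Suppose that in some iteration, producing $f_{\mathit{next}}$ from $f$, the grandparent vector is unchanged, i.e. $f_{\mathit{next}}[f_{\mathit{next}}[u]] = f[f[u]]$ for all $u\in V$. Then the parent vector never changes afterwards: every subsequent iteration returns exactly its input vector.
   Context: The algorithm maintains a parent vector $f:V\to V$, initialized by $f[u]=u$ for all $u$. One iteration maps the current vector $f$ to a new vector $f_{\mathit{next}}$ as follows. Start with $f_{\mathit{next}}=f$. (1) Stochastic hooking: for every $(u,v)\in E$, set $f_{\mathit{next}}[f[u]]\leftarrow \min(f_{\mathit{next}}[f[u]],\, f[f[v]])$. (2) Aggressive hooking: for every $(u,v)\in E$, set $f_{\mathit{next}}[u]\leftarrow\min(f_{\mathit{next}}[u],\, f[f[v]])$. (3) Shortcutting: for every $u\in V$, set $f_{\mathit{next}}[u]\leftarrow\min(f_{\mathit{next}}[u],\, f[f[u]])$. All right-hand sides read the old vector $f$; the result does not depend on the order of updates. Then $f$ is replaced by $f_{\mathit{next}}$ and the next iteration begins. Equivalently, $f_{\mathit{next}}[w]=\min\big(\{f[w],f[f[w]]\}\cup\{f[f[v]]:(w,v)\in E\}\cup\{f[f[v]]:(u,v)\in E,\ f[u]=w\}\big)$. -}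

module Defs where

open import Data.Nat using (ℕ; zero; suc; _≤_)
open import Data.Nat.Properties using (_≤?_)
open import Data.Fin using (Fin; toℕ)
open import Data.Fin.Properties using (_≟_)
open import Data.List using (List; foldr)
open import Data.Product using (_×_; _,_)
open import Data.List.Membership.Propositional using (_∈_)
open import Relation.Nullary using (yes; no)

ParentVec : ℕ → Set
ParentVec n = Fin n → Fin n

minV : {n : ℕ} → Fin n → Fin n → Fin n
minV a b with toℕ a ≤? toℕ b
... | yes _ = a
... | no  _ = b

Symmetric : {n : ℕ} → List (Fin n × Fin n) → Set
Symmetric E = ∀ u v → (u , v) ∈ E → (v , u) ∈ E

-- contribution of an edge (u,v) to f_next[w]:
-- aggressive hooking if u = w, stochastic hooking if f[u] = w.
edgeContrib : {n : ℕ} → ParentVec n → Fin n → Fin n × Fin n → Fin n → Fin n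
edgeContrib f w (u , v) acc with u ≟ w | f u ≟ w
... | yes _ | _     = minV acc (f (f v))
... | no _  | yes _ = minV acc (f (f v))
... | no _  | no _  = acc

-- One iteration:
-- f_next[w] = min({f[w], f[f[w]]} ∪ {f[f[v]] : (w,v) ∈ E} ∪ {f[f[v]] : (u,v) ∈ E, f[u] = w})
step : {n : ℕ} → List (Fin n × Fin n) → ParentVec n → ParentVec n
step E f w = foldr (edgeContrib f w) (minV (f w) (f (f w))) E

iter : {n : ℕ} → List (Fin n × Fin n) → ℕ → ParentVec n
iter E zero    = λ u → u
iter E (suc k) = step E (iter E k)

-- Each vertex only ever decreases: f_next[w] ≤ f[w], f[f[w]] and f[f[v]] for every edge
-- (w,v). Put g = f_next and suppose g∘g = f∘f. Then every candidate value that the next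
-- iteration offers to g[w] is bounded below by g[w]: g[g[w]] = f[f[w]] ≥ g[w]; an aggressive
-- hook along (w,v) offers g[g[v]] = f[f[v]] ≥ g[w]; a stochastic hook along (u,v) with
-- g[u] = w offers g[g[v]] = f[f[v]] ≥ g[u] ≥ g[g[u]] = g[w]. So g is a fixed point of the
-- iteration, and it is never left again.
module Submission where

open import Defs
open import Data.Nat using (ℕ; zero; suc; _+_)
import Data.Nat.Properties as ℕ
open import Data.Nat.Properties using (+-identityʳ; +-suc)
open import Data.Fin using (Fin; toℕ; _≤_)
open import Data.Fin.Properties using (_≟_; ≤-refl; ≤-trans)
open import Data.List using (List; []; _∷_; foldr)
open import Data.List.Relation.Unary.Any using (here; there)
open import Data.List.Membership.Propositional using (_∈_)
open import Data.Product using (_×_; _,_)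
open import Data.Sum using (_⊎_; inj₁; inj₂)
open import Data.Empty using (⊥-elim)
open import Relation.Nullary using (yes; no)
open import Relation.Binary.PropositionalEquality
  using (_≡_; _≗_; refl; sym; trans; cong; cong₂; subst)

module _ {n : ℕ} where

  minV-≤ˡ : (a b : Fin n) → minV a b ≤ a
  minV-≤ˡ a b with toℕ a ℕ.≤? toℕ b
  ... | yes _   = ≤-refl
  ... | no a≰b = ℕ.<⇒≤ (ℕ.≰⇒> a≰b)

  minV-≤ʳ : (a b : Fin n) → minV a b ≤ b
  minV-≤ʳ a b with toℕ a ℕ.≤? toℕ b
  ... | yes a≤b = a≤b
  ... | no _    = ≤-refl

  minV-of-≤ : {a b : Fin n} → a ≤ b → minV a b ≡ a
  minV-of-≤ {a} {b} a≤b with toℕ a ℕ.≤? toℕ b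
  ... | yes _   = refl
  ... | no a≰b = ⊥-elim (a≰b a≤b)

  Hooks : ParentVec n → Fin n → Fin n × Fin n → Set
  Hooks f w (u , v) = u ≡ w ⊎ f u ≡ w

  edgeContrib-≤ : (f : ParentVec n) (w : Fin n) (e : Fin n × Fin n) (acc : Fin n)
                → edgeContrib f w e acc ≤ acc
  edgeContrib-≤ f w (u , v) acc with u ≟ w | f u ≟ w
  ... | yes _ | _     = minV-≤ˡ acc (f (f v))
  ... | no _  | yes _ = minV-≤ˡ acc (f (f v))
  ... | no _  | no _  = ≤-refl

  edgeContrib-idle : (f : ParentVec n) (w u v acc : Fin n)
                   → (Hooks f w (u , v) → acc ≤ f (f v))
                   → edgeContrib f w (u , v) acc ≡ acc
  edgeContrib-idle f w u v acc bound with u ≟ w | f u ≟ w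
  ... | yes u≡w | _       = minV-of-≤ (bound (inj₁ u≡w))
  ... | no _    | yes fu≡w = minV-of-≤ (bound (inj₂ fu≡w))
  ... | no _    | no _     = refl

  edgeContrib-cong : {f f′ : ParentVec n} → f ≗ f′ → (w : Fin n) (e : Fin n × Fin n) (acc : Fin n)
                   → edgeContrib f w e acc ≡ edgeContrib f′ w e acc
  edgeContrib-cong {f} {f′} f≗f′ w (u , v) acc with u ≟ w | f u ≟ w | f′ u ≟ w
  ... | yes _ | _       | _        = cong (minV acc) (trans (cong f (f≗f′ v)) (f≗f′ (f′ v)))
  ... | no _  | yes _   | yes _    = cong (minV acc) (trans (cong f (f≗f′ v)) (f≗f′ (f′ v)))
  ... | no _  | yes fu≡w | no f′u≢w = ⊥-elim (f′u≢w (trans (sym (f≗f′ u)) fu≡w))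
  ... | no _  | no fu≢w  | yes f′u≡w = ⊥-elim (fu≢w (trans (f≗f′ u) f′u≡w))
  ... | no _  | no _     | no _     = refl

  module _ (E : List (Fin n × Fin n)) where

    foldr-edgeContrib-≤ : (f : ParentVec n) (w : Fin n) (L : List (Fin n × Fin n)) (a : Fin n)
                        → foldr (edgeContrib f w) a L ≤ a
    foldr-edgeContrib-≤ f w []      a = ≤-refl
    foldr-edgeContrib-≤ f w (e ∷ L) a =
      ≤-trans (edgeContrib-≤ f w e _) (foldr-edgeContrib-≤ f w L a)

    foldr-edgeContrib-≤-edge : (f : ParentVec n) (w v : Fin n) (L : List (Fin n × Fin n)) (a : Fin n)
                             → (w , v) ∈ L → foldr (edgeContrib f w) a L ≤ f (f v)
    foldr-edgeContrib-≤-edge f w v (_ ∷ L) a (here refl) with w ≟ w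
    ... | yes _  = minV-≤ʳ (foldr (edgeContrib f w) a L) (f (f v))
    ... | no w≢w = ⊥-elim (w≢w refl)
    foldr-edgeContrib-≤-edge f w v (e ∷ L) a (there wv∈L) =
      ≤-trans (edgeContrib-≤ f w e _) (foldr-edgeContrib-≤-edge f w v L a wv∈L)

    step-≤-parent : (f : ParentVec n) (w : Fin n) → step E f w ≤ f w
    step-≤-parent f w = ≤-trans (foldr-edgeContrib-≤ f w E _) (minV-≤ˡ (f w) (f (f w)))

    step-≤-grandparent : (f : ParentVec n) (w : Fin n) → step E f w ≤ f (f w)
    step-≤-grandparent f w = ≤-trans (foldr-edgeContrib-≤ f w E _) (minV-≤ʳ (f w) (f (f w)))

    step-≤-edge : (f : ParentVec n) {w v : Fin n} → (w , v) ∈ E → step E f w ≤ f (f v)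
    step-≤-edge f {w} {v} = foldr-edgeContrib-≤-edge f w v E _

    iter-≤ : (k : ℕ) (w : Fin n) → iter E k w ≤ w
    iter-≤ zero    w = ≤-refl
    iter-≤ (suc k) w = ≤-trans (step-≤-parent (iter E k) w) (iter-≤ k w)

    step-cong : {f f′ : ParentVec n} → f ≗ f′ → step E f ≗ step E f′
    step-cong {f} {f′} f≗f′ w =
      trans (foldr-cong E)
            (cong (λ a → foldr (edgeContrib f′ w) a E)
                  (cong₂ minV (f≗f′ w) (trans (cong f (f≗f′ w)) (f≗f′ (f′ w)))))
      where
      foldr-cong : ∀ L {a} → foldr (edgeContrib f w) a L ≡ foldr (edgeContrib f′ w) a L
      foldr-cong []      = refl
      foldr-cong (e ∷ L) = trans (cong (edgeContrib f w e) (foldr-cong L))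
                                 (edgeContrib-cong f≗f′ w e _)

    step-fixed : (f : ParentVec n)
               → (∀ w → f w ≤ f (f w))
               → (∀ w {u v} → (u , v) ∈ E → Hooks f w (u , v) → f w ≤ f (f v))
               → step E f ≗ f
    step-fixed f grand hook w =
      trans (cong (λ a → foldr (edgeContrib f w) a E) (minV-of-≤ (grand w)))
            (foldr-idle E (λ e∈E → e∈E))
      where
      foldr-idle : ∀ L → (∀ {e} → e ∈ L → e ∈ E) → foldr (edgeContrib f w) (f w) L ≡ f w
      foldr-idle []      _   = refl
      foldr-idle ((u , v) ∷ L) L⊆E =
        trans (cong (edgeContrib f w (u , v)) (foldr-idle L (λ e∈L → L⊆E (there e∈L))))
              (edgeContrib-idle f w u v (f w) (hook w (L⊆E (here refl))))

    step-fixed-of-grandparents : (f : ParentVec n)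
                               → (∀ w → step E f w ≤ w)
                               → (∀ w → step E f (step E f w) ≡ f (f w))
                               → step E (step E f) ≗ step E f
    step-fixed-of-grandparents f g-≤ gg≡ff = step-fixed g grand hook
      where
      g : ParentVec n
      g = step E f

      ff≤gg : ∀ v → f (f v) ≤ g (g v)
      ff≤gg v = subst (f (f v) ≤_) (sym (gg≡ff v)) ≤-refl

      grand : ∀ w → g w ≤ g (g w)
      grand w = ≤-trans (step-≤-grandparent f w) (ff≤gg w)

      hook : ∀ w {u v} → (u , v) ∈ E → Hooks g w (u , v) → g w ≤ g (g v)
      hook w uv∈E (inj₁ refl) = ≤-trans (step-≤-edge f uv∈E) (ff≤gg _)
      hook w uv∈E (inj₂ refl) =
        ≤-trans (g-≤ _) (≤-trans (step-≤-edge f uv∈E) (ff≤gg _))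

    iter-stays-fixed : (k : ℕ) → step E (iter E k) ≗ iter E k → ∀ j → iter E (k + j) ≗ iter E k
    iter-stays-fixed k fixed zero    rewrite +-identityʳ k = λ _ → refl
    iter-stays-fixed k fixed (suc j) rewrite +-suc k j =
      λ u → trans (step-cong (iter-stays-fixed k fixed j) u) (fixed u)

lemma1 : (n : ℕ) (E : List (Fin n × Fin n)) → Symmetric E → (k : ℕ)
         → (∀ u → iter E (suc k) (iter E (suc k) u) ≡ iter E k (iter E k u))
         → ∀ j u → step E (iter E (suc k + j)) u ≡ iter E (suc k + j) u
lemma1 n E _ k grandparents-unchanged j u =
  trans (step-cong E stays u) (trans (fixed u) (sym (stays u)))
  where
  fixed : step E (iter E (suc k)) ≗ iter E (suc k)
  fixed = step-fixed-of-grandparents E (iter E k) (iter-≤ E (suc k)) grandparents-unchanged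

  stays : iter E (suc k + j) ≗ iter E (suc k)
  stays = iter-stays-fixed E (suc k) fixed j
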